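{- Let $G$ be a finite undirected graph with two distinct vertices $s,t$, and suppose $G$ contains a fork gadget $F$ (as defined in the context) none of whose six vertices $v,a,b,c,w,z$ is $s$ or $t$. In any non-transitive $st$-orientation of $G$, the edges $e_9$ and $e_{10}$ of $F$ are either both oriented exiting $F$ or both oriented entering $F$; moreover, they are oriented exiting $F$ if and only if the edge $e_1$ is oriented entering $F$.
   Context: An $st$-orientation of $G$ is an assignment of a direction to each edge such that the resulting digraph is acyclic with $s$ as unique source and $t$ as unique sink. An edge directed from $u$ to $v$ is transitive if there is a directed path from $u$ to $v$ avoiding that edge; the orientation is non-transitive if no edge is transitive. A fork gadget $F$ in $G$ consists of six distinct vertices $v,a,b,c,w,z$ together with the ten edges $e_2=(v,a)$, $e_3=(v,b)$, $e_4=(v,c)$, $e_5=(a,w)$, $e_6=(b,w)$, $e_7=(b,z)$, $e_8=(c,z)$, and $e_1=(p,v)$, $e_9=(w,q)$, $e_{10}=(z,r)$ where $p,q,r$ are vertices of $G$ not among $v,a,b,c,w,z$; these ten edges are the only edges of $G$ incident to $v,a,b,c,w,z$. The edge $e_1$ is oriented entering $F$ if it is directed from $p$ to $v$, and exiting $F$ otherwise; $e_9$ (resp. $e_{10}$) is oriented entering $F$ if directed from $q$ to $w$ (resp. from $r$ to $z$), and exiting $F$ otherwise. -}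

module Defs where

open import Data.Nat using (ℕ)
open import Data.Fin using (Fin)
open import Data.Product using (_×_; Σ; ∃; ∃-syntax; _,_)
open import Data.Sum using (_⊎_)
open import Relation.Binary.PropositionalEquality using (_≡_; _≢_)
open import Relation.Nullary using (¬_)
open import Data.Empty using (⊥)

record Graph (n : ℕ) : Set₁ where
  field
    Adj     : Fin n → Fin n → Set
    sym     : ∀ {x y} → Adj x y → Adj y x
    irrefl  : ∀ {x} → ¬ Adj x x

open Graph public

record Orientation {n : ℕ} (G : Graph n) : Set₁ where
  field
    Arc      : Fin n → Fin n → Set
    arc-edge : ∀ {u v} → Arc u v → Adj G u v
    edge-arc : ∀ {u v} → Adj G u v → Arc u v ⊎ Arc v u
    antisym  : ∀ {u v} → Arc u v → ¬ Arc v u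

open Orientation public

data Path {n : ℕ} (R : Fin n → Fin n → Set) : Fin n → Fin n → Set where
  one  : ∀ {x y}   → R x y → Path R x y
  cons : ∀ {x y z} → R x y → Path R y z → Path R x z

Without : {n : ℕ} → (Fin n → Fin n → Set) → Fin n → Fin n → Fin n → Fin n → Set
Without R u v x y = R x y × ¬ (x ≡ u × y ≡ v)

record IsSTOrientation {n : ℕ} {G : Graph n} (O : Orientation G) (s t : Fin n) : Set where
  field
    acyclic     : ∀ x → ¬ Path (Arc O) x x
    s-source    : ∀ x → ¬ Arc O x s
    t-sink      : ∀ x → ¬ Arc O t x
    only-source : ∀ x → x ≢ s → ∃[ y ] Arc O y x
    only-sink   : ∀ x → x ≢ t → ∃[ y ] Arc O x y

Transitive : {n : ℕ} {G : Graph n} → Orientation G → Fin n → Fin n → Set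
Transitive O u v = Arc O u v × Path (Without (Arc O) u v) u v

NonTransitive : {n : ℕ} {G : Graph n} → Orientation G → Set
NonTransitive O = ∀ u v → ¬ Transitive O u v

SameEdge : {n : ℕ} → Fin n → Fin n → Fin n → Fin n → Set
SameEdge x y u v = (x ≡ u × y ≡ v) ⊎ (x ≡ v × y ≡ u)

record ForkGadget {n : ℕ} (G : Graph n) (v a b c w z p q r : Fin n) : Set where
  field
    v≢a : v ≢ a
    v≢b : v ≢ b
    v≢c : v ≢ c
    v≢w : v ≢ w
    v≢z : v ≢ z
    a≢b : a ≢ b
    a≢c : a ≢ c
    a≢w : a ≢ w
    a≢z : a ≢ z
    b≢c : b ≢ c
    b≢w : b ≢ w
    b≢z : b ≢ z
    c≢w : c ≢ w
    c≢z : c ≢ z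
    w≢z : w ≢ z
    p-out : ¬ (p ≡ v ⊎ p ≡ a ⊎ p ≡ b ⊎ p ≡ c ⊎ p ≡ w ⊎ p ≡ z)
    q-out : ¬ (q ≡ v ⊎ q ≡ a ⊎ q ≡ b ⊎ q ≡ c ⊎ q ≡ w ⊎ q ≡ z)
    r-out : ¬ (r ≡ v ⊎ r ≡ a ⊎ r ≡ b ⊎ r ≡ c ⊎ r ≡ w ⊎ r ≡ z)
    e1  : Adj G p v
    e2  : Adj G v a
    e3  : Adj G v b
    e4  : Adj G v c
    e5  : Adj G a w
    e6  : Adj G b w
    e7  : Adj G b z
    e8  : Adj G c z
    e9  : Adj G w q
    e10 : Adj G z r
    only : ∀ x y → Adj G x y →
           (x ≡ v ⊎ x ≡ a ⊎ x ≡ b ⊎ x ≡ c ⊎ x ≡ w ⊎ x ≡ z) →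
           SameEdge x y p v ⊎ SameEdge x y v a ⊎ SameEdge x y v b ⊎
           SameEdge x y v c ⊎ SameEdge x y a w ⊎ SameEdge x y b w ⊎
           SameEdge x y b z ⊎ SameEdge x y c z ⊎ SameEdge x y w q ⊎
           SameEdge x y z r

{-# OPTIONS --safe #-}
-- Every inner vertex of an st-orientation has an incoming and an outgoing arc, so at a
-- vertex all of whose edges but one are oriented the same way the last edge is forced
-- the other way.  If v → a, forcing and non-transitivity propagate through the gadget:
-- a → w, v → b, b → w, v → c, c → z, b → z, hence w → q, z → r and p → v.  Reversing
-- every arc turns a non-transitive st-orientation into a non-transitive ts-orientation,
-- so the case a → v is the mirror image of v → a.
module Submission where

open import Defs hiding (sym)
open import Data.Nat using (ℕ)
open import Data.Fin using (Fin)
open import Data.List using (List; []; _∷_)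
open import Data.List.Membership.Propositional using (_∈_)
open import Data.List.Relation.Unary.All as All using (All; []; _∷_)
open import Data.List.Relation.Unary.Any using (here; there)
open import Data.Product using (_×_; _,_) renaming (swap to ×-swap)
open import Data.Sum using (_⊎_; inj₁; inj₂; [_,_]′) renaming (swap to ⊎-swap)
open import Data.Empty using (⊥-elim)
open import Function using (_∘_; flip; const)
open import Relation.Binary.PropositionalEquality using (_≡_; _≢_; refl; sym; subst)
open import Relation.Nullary using (¬_)
open import Function.Bundles using (_⇔_; mk⇔)

module _ {n : ℕ} where

  Path-map : ∀ {R S : Fin n → Fin n → Set} → (∀ {x y} → R x y → S x y) →
             ∀ {x y} → Path R x y → Path S x y
  Path-map f (one xy)       = one (f xy)
  Path-map f (cons xy path) = cons (f xy) (Path-map f path)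

  Path-snoc : ∀ {R : Fin n → Fin n → Set} {x y z} → Path R x y → R y z → Path R x z
  Path-snoc (one xy)       yz = cons xy (one yz)
  Path-snoc (cons xy path) yz = cons xy (Path-snoc path yz)

  Path-reverse : ∀ {R : Fin n → Fin n → Set} {x y} → Path R x y → Path (flip R) y x
  Path-reverse (one xy)       = one xy
  Path-reverse (cons xy path) = Path-snoc (Path-reverse path) xy

module _ {n : ℕ} {G : Graph n} where

  reverse : Orientation G → Orientation G
  reverse O = record
    { Arc      = flip (Arc O)
    ; arc-edge = Graph.sym G ∘ arc-edge O
    ; edge-arc = ⊎-swap ∘ edge-arc O
    ; antisym  = antisym O
    }

  reverse-isSTOrientation : ∀ {O : Orientation G} {s t} →
                            IsSTOrientation O s t → IsSTOrientation (reverse O) t s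
  reverse-isSTOrientation st = record
    { acyclic     = λ x → acyclic x ∘ Path-reverse
    ; s-source    = t-sink
    ; t-sink      = s-source
    ; only-source = only-sink
    ; only-sink   = only-source
    }
    where open IsSTOrientation st

  reverse-nonTransitive : (O : Orientation G) → NonTransitive O → NonTransitive (reverse O)
  reverse-nonTransitive O nt u v (vu , path) =
    nt v u (vu , Path-map (λ (xy , ≢uv) → xy , ≢uv ∘ ×-swap) (Path-reverse path))

  -- The three side conditions that make x → y → u → k avoid the arc x → k
  -- follow from antisymmetry and irreflexivity, so no distinctness hypotheses are needed.
  no-bypass : (O : Orientation G) → NonTransitive O →
              ∀ {x y u k} → Arc O x y → Arc O y u → Arc O u k → ¬ Arc O x k
  no-bypass O nt xy yu uk xk = nt _ _ (xk ,
    cons (xy , λ { (_ , refl) → antisym O yu uk })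
      (cons (yu , λ { (refl , _) → irrefl G (arc-edge O xy) })
        (one (uk , λ { (refl , _) → antisym O xy yu }))))

  Neighbours : Fin n → List (Fin n) → Set
  Neighbours x ys = ∀ {y} → Adj G x y → y ∈ ys

  forced-out : ∀ {O : Orientation G} {s t} → IsSTOrientation O s t →
               ∀ {x y₀ ys} → x ≢ t → Neighbours x (y₀ ∷ ys) →
               All (λ y → Arc O y x) ys → Arc O x y₀
  forced-out {O} st x≢t neighbours ins with IsSTOrientation.only-sink st _ x≢t
  ... | y , xy with neighbours (arc-edge O xy)
  ... | here refl  = xy
  ... | there y∈ys = ⊥-elim (antisym O xy (All.lookup ins y∈ys))

  forced-in : ∀ {O : Orientation G} {s t} → IsSTOrientation O s t →
              ∀ {x y₀ ys} → x ≢ s → Neighbours x (y₀ ∷ ys) →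
              All (λ y → Arc O x y) ys → Arc O y₀ x
  forced-in st = forced-out (reverse-isSTOrientation st)

module Fork {n : ℕ} (G : Graph n) {v a b c w z p q r : Fin n}
            (F : ForkGadget G v a b c w z p q r) where

  open ForkGadget F

  InFork : Fin n → Set
  InFork x = x ≡ v ⊎ x ≡ a ⊎ x ≡ b ⊎ x ≡ c ⊎ x ≡ w ⊎ x ≡ z

  data Node : Set where
    V A B C W Z : Node

  ⟦_⟧ : Node → Fin n
  ⟦ V ⟧ = v
  ⟦ A ⟧ = a
  ⟦ B ⟧ = b
  ⟦ C ⟧ = c
  ⟦ W ⟧ = w
  ⟦ Z ⟧ = z

  ⟦⟧-inFork : ∀ i → InFork ⟦ i ⟧
  ⟦⟧-inFork V = inj₁ refl
  ⟦⟧-inFork A = inj₂ (inj₁ refl)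
  ⟦⟧-inFork B = inj₂ (inj₂ (inj₁ refl))
  ⟦⟧-inFork C = inj₂ (inj₂ (inj₂ (inj₁ refl)))
  ⟦⟧-inFork W = inj₂ (inj₂ (inj₂ (inj₂ (inj₁ refl))))
  ⟦⟧-inFork Z = inj₂ (inj₂ (inj₂ (inj₂ (inj₂ refl))))

  ⟦⟧-avoids : ∀ {x} → ¬ InFork x → ∀ i → ⟦ i ⟧ ≢ x
  ⟦⟧-avoids x∉F i refl = x∉F (⟦⟧-inFork i)

  ⟦⟧-injective : ∀ i j → ⟦ i ⟧ ≡ ⟦ j ⟧ → i ≡ j
  ⟦⟧-injective V V _ = refl
  ⟦⟧-injective A A _ = refl
  ⟦⟧-injective B B _ = refl
  ⟦⟧-injective C C _ = refl
  ⟦⟧-injective W W _ = refl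
  ⟦⟧-injective Z Z _ = refl
  ⟦⟧-injective V A e = ⊥-elim (v≢a e)
  ⟦⟧-injective V B e = ⊥-elim (v≢b e)
  ⟦⟧-injective V C e = ⊥-elim (v≢c e)
  ⟦⟧-injective V W e = ⊥-elim (v≢w e)
  ⟦⟧-injective V Z e = ⊥-elim (v≢z e)
  ⟦⟧-injective A B e = ⊥-elim (a≢b e)
  ⟦⟧-injective A C e = ⊥-elim (a≢c e)
  ⟦⟧-injective A W e = ⊥-elim (a≢w e)
  ⟦⟧-injective A Z e = ⊥-elim (a≢z e)
  ⟦⟧-injective B C e = ⊥-elim (b≢c e)
  ⟦⟧-injective B W e = ⊥-elim (b≢w e)
  ⟦⟧-injective B Z e = ⊥-elim (b≢z e)
  ⟦⟧-injective C W e = ⊥-elim (c≢w e)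
  ⟦⟧-injective C Z e = ⊥-elim (c≢z e)
  ⟦⟧-injective W Z e = ⊥-elim (w≢z e)
  ⟦⟧-injective A V e = ⊥-elim (v≢a (sym e))
  ⟦⟧-injective B V e = ⊥-elim (v≢b (sym e))
  ⟦⟧-injective C V e = ⊥-elim (v≢c (sym e))
  ⟦⟧-injective W V e = ⊥-elim (v≢w (sym e))
  ⟦⟧-injective Z V e = ⊥-elim (v≢z (sym e))
  ⟦⟧-injective B A e = ⊥-elim (a≢b (sym e))
  ⟦⟧-injective C A e = ⊥-elim (a≢c (sym e))
  ⟦⟧-injective W A e = ⊥-elim (a≢w (sym e))
  ⟦⟧-injective Z A e = ⊥-elim (a≢z (sym e))
  ⟦⟧-injective C B e = ⊥-elim (b≢c (sym e))
  ⟦⟧-injective W B e = ⊥-elim (b≢w (sym e))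
  ⟦⟧-injective Z B e = ⊥-elim (b≢z (sym e))
  ⟦⟧-injective W C e = ⊥-elim (c≢w (sym e))
  ⟦⟧-injective Z C e = ⊥-elim (c≢z (sym e))
  ⟦⟧-injective Z W e = ⊥-elim (w≢z (sym e))

  -- Each list starts with the neighbour whose edge gets forced.
  neighbours : Node → List (Fin n)
  neighbours V = p ∷ a ∷ b ∷ c ∷ []
  neighbours A = w ∷ v ∷ []
  neighbours B = v ∷ w ∷ z ∷ []
  neighbours C = z ∷ v ∷ []
  neighbours W = q ∷ a ∷ b ∷ []
  neighbours Z = r ∷ b ∷ c ∷ []

  inner-edge : ∀ {i y} j k → ⟦ k ⟧ ∈ neighbours j → ⟦ j ⟧ ∈ neighbours k →
               SameEdge ⟦ i ⟧ y ⟦ j ⟧ ⟦ k ⟧ → y ∈ neighbours i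
  inner-edge {i} j k k∈ _ (inj₁ (i≡j , refl)) =
    subst (λ l → ⟦ k ⟧ ∈ neighbours l) (sym (⟦⟧-injective i j i≡j)) k∈
  inner-edge {i} j k _ j∈ (inj₂ (i≡k , refl)) =
    subst (λ l → ⟦ j ⟧ ∈ neighbours l) (sym (⟦⟧-injective i k i≡k)) j∈

  outer-edge : ∀ {i y o} j → ¬ InFork o → o ∈ neighbours j →
               SameEdge ⟦ i ⟧ y ⟦ j ⟧ o → y ∈ neighbours i
  outer-edge {i} {o = o} j _ o∈ (inj₁ (i≡j , refl)) =
    subst (λ l → o ∈ neighbours l) (sym (⟦⟧-injective i j i≡j)) o∈
  outer-edge {i} j o∉F _ (inj₂ (i≡o , _)) = ⊥-elim (⟦⟧-avoids o∉F i i≡o)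

  neighbours-complete : ∀ i → Neighbours {G = G} ⟦ i ⟧ (neighbours i)
  neighbours-complete i e =
    [ outer-edge V p-out (here refl) ∘ ⊎-swap
    , [ inner-edge V A (there (here refl)) (there (here refl))
    , [ inner-edge V B (there (there (here refl))) (here refl)
    , [ inner-edge V C (there (there (there (here refl)))) (there (here refl))
    , [ inner-edge A W (here refl) (there (here refl))
    , [ inner-edge B W (there (here refl)) (there (there (here refl)))
    , [ inner-edge B Z (there (there (here refl))) (there (here refl))
    , [ inner-edge C Z (here refl) (there (there (here refl)))
    , [ outer-edge W q-out (here refl)
      , outer-edge Z r-out (here refl)
      ]′ ]′ ]′ ]′ ]′ ]′ ]′ ]′ ]′ (only ⟦ i ⟧ _ e (⟦⟧-inFork i))

  module _ {O : Orientation G} {s t : Fin n} (st : IsSTOrientation O s t)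
           (nt : NonTransitive O) (s∉F : ¬ InFork s) (t∉F : ¬ InFork t) where

    open IsSTOrientation st using (acyclic)

    fork-downward : Arc O v a → Arc O w q × Arc O z r × Arc O p v
    fork-downward va = forced-out st (⟦⟧-avoids t∉F W) (neighbours-complete W) (aw ∷ bw ∷ [])
                     , forced-out st (⟦⟧-avoids t∉F Z) (neighbours-complete Z) (bz ∷ cz ∷ [])
                     , forced-in st (⟦⟧-avoids s∉F V) (neighbours-complete V) (va ∷ vb ∷ vc ∷ [])
      where
      aw : Arc O a w
      aw = forced-out st (⟦⟧-avoids t∉F A) (neighbours-complete A) (va ∷ [])

      vb : Arc O v b
      vb with edge-arc O e3 | edge-arc O e6
      ... | inj₁ vb | _       = vb
      ... | inj₂ bv | inj₁ bw = ⊥-elim (no-bypass O nt bv va aw bw)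
      ... | inj₂ bv | inj₂ wb = ⊥-elim (acyclic b (cons bv (cons va (cons aw (one wb)))))

      bw : Arc O b w
      bw with edge-arc O e6
      ... | inj₁ bw = bw
      ... | inj₂ wb = ⊥-elim (no-bypass O nt va aw wb vb)

      zc : Arc O c v → Arc O z c
      zc cv = forced-in st (⟦⟧-avoids s∉F C) (neighbours-complete C) (cv ∷ [])

      vc : Arc O v c
      vc with edge-arc O e4 | edge-arc O e7
      ... | inj₁ vc | _       = vc
      ... | inj₂ cv | inj₁ bz = ⊥-elim (acyclic v (cons vb (cons bz (cons (zc cv) (one cv)))))
      ... | inj₂ cv | inj₂ zb = ⊥-elim (no-bypass O nt (zc cv) cv vb zb)

      cz : Arc O c z
      cz = forced-out st (⟦⟧-avoids t∉F C) (neighbours-complete C) (vc ∷ [])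

      bz : Arc O b z
      bz with edge-arc O e7
      ... | inj₁ bz = bz
      ... | inj₂ zb = ⊥-elim (no-bypass O nt vc cz zb vb)

lemma1 : {n : ℕ} (G : Graph n) (s t : Fin n) → s ≢ t →
         (v a b c w z p q r : Fin n) → ForkGadget G v a b c w z p q r →
         ¬ (s ≡ v ⊎ s ≡ a ⊎ s ≡ b ⊎ s ≡ c ⊎ s ≡ w ⊎ s ≡ z) →
         ¬ (t ≡ v ⊎ t ≡ a ⊎ t ≡ b ⊎ t ≡ c ⊎ t ≡ w ⊎ t ≡ z) →
         (O : Orientation G) → IsSTOrientation O s t → NonTransitive O →
         ((Arc O w q × Arc O z r) ⊎ (Arc O q w × Arc O r z))
         × ((Arc O w q × Arc O z r) ⇔ Arc O p v)
lemma1 G s t _ v a b c w z p q r F s∉F t∉F O st nt with edge-arc O (ForkGadget.e2 F)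
... | inj₁ va =
  let wq , zr , pv = Fork.fork-downward G F st nt s∉F t∉F va
  in inj₁ (wq , zr) , mk⇔ (const pv) (const (wq , zr))
... | inj₂ av =
  let qw , rz , vp = Fork.fork-downward G F (reverse-isSTOrientation st)
                                         (reverse-nonTransitive O nt) t∉F s∉F av
  in inj₂ (qw , rz) , mk⇔ (λ (wq , _) → ⊥-elim (antisym O wq qw))
                          (λ pv → ⊥-elim (antisym O pv vp))
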